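{- Let $Y$ be a finite set, $\mathbb{M}$ a complete MV-chain, $f:\mathbb{M}^Y\to\mathbb{M}^Y$ a monotone function and $H_{\min}$ a min-decomposition of $f$. For every strategy $C$ in $H_{\min}$ the following are equivalent: (1) $\mu f_C$ is not a fixpoint of $f$; (2) $C$ has at least one min-improvement; (3) $f(\mu f_C)\sqsubset\mu f_C$.
   Context: An MV-algebra is a tuple $(\mathbb{M},\oplus,0,\overline{(\cdot)})$ where $(\mathbb{M},\oplus,0)$ is a commutative monoid and $\overline{(\cdot)}:\mathbb{M}\to\mathbb{M}$ satisfies, for all $x,y$: $\overline{\overline{x}}=x$, $x\oplus\overline{0}=\overline{0}$, and $\overline{(\overline{x}\oplus y)}\oplus y=\overline{(\overline{y}\oplus x)}\oplus x$. The natural order is $x\sqsubseteq y$ iff $x\oplus z=y$ for some $z\in\mathbb{M}$. An MV-chain is an MV-algebra whose natural order is total; it is complete if it is a complete lattice under the natural order. $\mathbb{M}^Y$ carries the pointwise order; $a\sqsubset b$ means $a\sqsubseteq b$ and $a\neq b$. $\mu g$ denotes the least fixpoint of a monotone endofunction $g$ on a complete lattice. A min-decomposition of $f$ is a map $H_{\min}$ assigning to each $y\in Y$ a finite set $H_{\min}(y)$ of monotone functions $\mathbb{M}^Y\to\mathbb{M}$ such that $f(a)(y)=\min_{h\in H_{\min}(y)}h(a)$ for all $a\in\mathbb{M}^Y$, $y\in Y$. A strategy in $H_{\min}$ is a function $C$ on $Y$ with $C(y)\in H_{\min}(y)$ for all $y$; it induces the monotone map $f_C(a)(y)=C(y)(a)$.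 A strategy $C'$ is a min-improvement of a strategy $C$ if $f_{C'}(\mu f_C)\sqsubset\mu f_C$. -}

module Defs where

open import Level using (0ℓ)
open import Data.Nat using (ℕ)
open import Data.Fin using (Fin)
open import Data.List using (List; map)
open import Data.List.Membership.Propositional using (_∈_)
open import Data.List.Relation.Unary.All using (All)
open import Data.Product using (Σ; ∃; _×_; _,_; proj₁)
open import Data.Sum using (_⊎_)
open import Relation.Nullary using (¬_)
open import Relation.Binary.PropositionalEquality using (_≡_)
open import Algebra.Structures using (IsCommutativeMonoid)

record MVAlgebra : Set₁ where
  infixl 6 _⊕_
  field
    M     : Set
    _⊕_   : M → M → M
    𝟘     : M
    ‾     : M → M
    isCommMonoid : IsCommutativeMonoid _≡_ _⊕_ 𝟘
    ‾-invol  : ∀ x → ‾ (‾ x) ≡ x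
    ‾0-absorb : ∀ x → x ⊕ ‾ 𝟘 ≡ ‾ 𝟘
    mv-law   : ∀ x y → ‾ (‾ x ⊕ y) ⊕ y ≡ ‾ (‾ y ⊕ x) ⊕ x

  _⊑_ : M → M → Set
  x ⊑ y = ∃ λ z → x ⊕ z ≡ y

IsChain : MVAlgebra → Set
IsChain 𝕄 = ∀ x y → x ⊑ y ⊎ y ⊑ x
  where open MVAlgebra 𝕄

IsComplete : MVAlgebra → Set₁
IsComplete 𝕄 = (P : M → Set) → Σ M λ s →
    (∀ x → P x → x ⊑ s) × (∀ u → (∀ x → P x → x ⊑ u) → s ⊑ u)
  where open MVAlgebra 𝕄

module _ (𝕄 : MVAlgebra) where
  open MVAlgebra 𝕄

  _⊑ᵖ_ : ∀ {n} → (Fin n → M) → (Fin n → M) → Set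
  a ⊑ᵖ b = ∀ y → a y ⊑ b y

  _≐_ : ∀ {n} → (Fin n → M) → (Fin n → M) → Set
  a ≐ b = ∀ y → a y ≡ b y

  _⊏ᵖ_ : ∀ {n} → (Fin n → M) → (Fin n → M) → Set
  a ⊏ᵖ b = a ⊑ᵖ b × ¬ (a ≐ b)

  MonotoneEndo : ∀ {n} → ((Fin n → M) → (Fin n → M)) → Set
  MonotoneEndo f = ∀ a b → a ⊑ᵖ b → f a ⊑ᵖ f b

  MonotoneComp : ∀ {n} → ((Fin n → M) → M) → Set
  MonotoneComp h = ∀ a b → a ⊑ᵖ b → h a ⊑ h b

  IsFixpoint : ∀ {n} → ((Fin n → M) → (Fin n → M)) → (Fin n → M) → Set
  IsFixpoint g m = g m ≐ m

  IsLeastFixpoint : ∀ {n} → ((Fin n → M) → (Fin n → M)) → (Fin n → M) → Set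
  IsLeastFixpoint g m = IsFixpoint g m × (∀ x → IsFixpoint g x → m ⊑ᵖ x)

  IsMinOf : M → List M → Set
  IsMinOf x xs = x ∈ xs × All (x ⊑_) xs

  IsMinDecomposition : ∀ {n} → ((Fin n → M) → (Fin n → M)) →
                       (Fin n → List ((Fin n → M) → M)) → Set
  IsMinDecomposition f H =
    (∀ y → All MonotoneComp (H y)) ×
    (∀ a y → IsMinOf (f a y) (map (λ h → h a) (H y)))

  Strategy : ∀ {n} → (Fin n → List ((Fin n → M) → M)) → Set
  Strategy {n} H = (y : Fin n) → Σ ((Fin n → M) → M) λ h → h ∈ H y

  induced : ∀ {n} {H : Fin n → List ((Fin n → M) → M)} →
            Strategy H → (Fin n → M) → (Fin n → M)
  induced C a y = proj₁ (C y) a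

  -- C' is a min-improvement of C, where μC = μ f_C
  IsMinImprovement : ∀ {n} {H : Fin n → List ((Fin n → M) → M)} →
                     (μC : Fin n → M) → Strategy H → Strategy H → Set
  IsMinImprovement μC C C' = induced C' μC ⊏ᵖ μC

{-# OPTIONS --safe #-}
-- f(μ f_C) is the pointwise minimum of the strategy values at μ f_C, so it lies
-- below f_C(μ f_C) = μ f_C and is attained by the strategy choosing a minimising
-- h at every y. Hence f(μ f_C) ⊏ μ f_C as soon as μ f_C is not a fixpoint of f,
-- and the minimising strategy is then a min-improvement; conversely every
-- f_{C'}(μ f_C) lies above f(μ f_C), so an improvement forces f(μ f_C) ⊏ μ f_C
-- by antisymmetry of the natural order.
module Submission where

open import Defs
open import Data.Nat using (ℕ)
open import Data.Fin using (Fin)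
open import Data.List using (List; map)
open import Data.List.Membership.Propositional using (_∈_)
open import Data.List.Membership.Propositional.Properties using (∈-map⁻)
import Data.List.Relation.Unary.All as All
import Data.List.Relation.Unary.All.Properties as All
open import Data.Product using (Σ; _×_; _,_; proj₁; proj₂)
open import Relation.Nullary using (¬_)
open import Relation.Binary.PropositionalEquality
  using (_≡_; refl; sym; trans; cong; subst; module ≡-Reasoning)
open import Algebra.Structures using (IsCommutativeMonoid)

module NaturalOrder (𝕄 : MVAlgebra) where
  open MVAlgebra 𝕄
  open IsCommutativeMonoid isCommMonoid using (assoc; comm; identityˡ)
  open ≡-Reasoning

  𝟙 : M
  𝟙 = ‾ 𝟘

  ‾𝟙⊕x≡x : ∀ x → ‾ 𝟙 ⊕ x ≡ x
  ‾𝟙⊕x≡x x = trans (cong (_⊕ x) (‾-invol 𝟘)) (identityˡ x)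

  ‾x⊕x≡𝟙 : ∀ x → ‾ x ⊕ x ≡ 𝟙
  ‾x⊕x≡𝟙 x = begin
    ‾ x ⊕ x                    ≡⟨ cong (λ t → ‾ t ⊕ x) (sym (‾𝟙⊕x≡x x)) ⟩
    ‾ (‾ 𝟙 ⊕ x) ⊕ x            ≡⟨ sym (mv-law x 𝟙) ⟩
    ‾ (‾ x ⊕ 𝟙) ⊕ 𝟙            ≡⟨ ‾0-absorb _ ⟩
    𝟙                          ∎

  x⊑y⇒‾x⊕y≡𝟙 : ∀ {x y} → x ⊑ y → ‾ x ⊕ y ≡ 𝟙
  x⊑y⇒‾x⊕y≡𝟙 {x} (z , refl) = begin
    ‾ x ⊕ (x ⊕ z)              ≡⟨ sym (assoc (‾ x) x z) ⟩
    (‾ x ⊕ x) ⊕ z              ≡⟨ cong (_⊕ z) (‾x⊕x≡𝟙 x) ⟩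
    𝟙 ⊕ z                      ≡⟨ comm 𝟙 z ⟩
    z ⊕ 𝟙                      ≡⟨ ‾0-absorb z ⟩
    𝟙                          ∎

  ⊑-trans : ∀ {x y z} → x ⊑ y → y ⊑ z → x ⊑ z
  ⊑-trans {x} (u , refl) (v , refl) = u ⊕ v , sym (assoc x u v)

  ⊑-antisym : ∀ {x y} → x ⊑ y → y ⊑ x → x ≡ y
  ⊑-antisym {x} {y} x⊑y y⊑x = begin
    x                          ≡⟨ sym (‾𝟙⊕x≡x x) ⟩
    ‾ 𝟙 ⊕ x                    ≡⟨ cong (λ t → ‾ t ⊕ x) (sym (x⊑y⇒‾x⊕y≡𝟙 y⊑x)) ⟩
    ‾ (‾ y ⊕ x) ⊕ x            ≡⟨ sym (mv-law x y) ⟩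
    ‾ (‾ x ⊕ y) ⊕ y            ≡⟨ cong (λ t → ‾ t ⊕ y) (x⊑y⇒‾x⊕y≡𝟙 x⊑y) ⟩
    ‾ 𝟙 ⊕ y                    ≡⟨ ‾𝟙⊕x≡x y ⟩
    y                          ∎

  module _ {n : ℕ} {a b c : Fin n → M} where

    ⊑ᵖ-⊏ᵖ-trans : _⊑ᵖ_ 𝕄 a b → _⊏ᵖ_ 𝕄 b c → _⊏ᵖ_ 𝕄 a c
    ⊑ᵖ-⊏ᵖ-trans a⊑b (b⊑c , b≉c) =
      (λ y → ⊑-trans (a⊑b y) (b⊑c y)) ,
      λ a≐c → b≉c λ y → ⊑-antisym (b⊑c y) (subst (_⊑ b y) (a≐c y) (a⊑b y))

    ≐-⊏ᵖ-trans : _≐_ 𝕄 a b → _⊏ᵖ_ 𝕄 b c → _⊏ᵖ_ 𝕄 a c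
    ≐-⊏ᵖ-trans a≐b (b⊑c , b≉c) =
      (λ y → subst (_⊑ c y) (sym (a≐b y)) (b⊑c y)) ,
      λ a≐c → b≉c λ y → trans (sym (a≐b y)) (a≐c y)

module MinDecomposition
  (𝕄 : MVAlgebra) {n : ℕ} {f : (Fin n → MVAlgebra.M 𝕄) → (Fin n → MVAlgebra.M 𝕄)}
  {H : Fin n → List ((Fin n → MVAlgebra.M 𝕄) → MVAlgebra.M 𝕄)}
  (isMinDecomposition : IsMinDecomposition 𝕄 f H) where
  open MVAlgebra 𝕄

  private
    isMin : ∀ a y → IsMinOf 𝕄 (f a y) (map (λ h → h a) (H y))
    isMin = proj₂ isMinDecomposition

  f⊑h : ∀ a y {h} → h ∈ H y → f a y ⊑ h a
  f⊑h a y = All.lookup (All.map⁻ (proj₂ (isMin a y)))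

  f⊑ᵖinduced : ∀ (C : Strategy 𝕄 H) a → _⊑ᵖ_ 𝕄 (f a) (induced 𝕄 C a)
  f⊑ᵖinduced C a y = f⊑h a y (proj₂ (C y))

  minimising-strategy : ∀ a → Σ (Strategy 𝕄 H) λ C → _≐_ 𝕄 (induced 𝕄 C a) (f a)
  minimising-strategy a = (λ y → proj₁ (attains y) , proj₁ (proj₂ (attains y))) ,
                          λ y → sym (proj₂ (proj₂ (attains y)))
    where
    attains : ∀ y → Σ _ λ h → h ∈ H y × f a y ≡ h a
    attains y = ∈-map⁻ (λ h → h a) (proj₁ (isMin a y))

mainTheorem6 : (𝕄 : MVAlgebra) → IsChain 𝕄 → IsComplete 𝕄 →
    (n : ℕ) → (f : (Fin n → MVAlgebra.M 𝕄) → (Fin n → MVAlgebra.M 𝕄)) →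
    MonotoneEndo 𝕄 f →
    (H : Fin n → List ((Fin n → MVAlgebra.M 𝕄) → MVAlgebra.M 𝕄)) →
    IsMinDecomposition 𝕄 f H →
    (C : Strategy 𝕄 H) → (μC : Fin n → MVAlgebra.M 𝕄) →
    IsLeastFixpoint 𝕄 (induced 𝕄 C) μC →
      ((¬ IsFixpoint 𝕄 f μC → Σ (Strategy 𝕄 H) (λ C' → IsMinImprovement 𝕄 μC C C'))
      × (Σ (Strategy 𝕄 H) (λ C' → IsMinImprovement 𝕄 μC C C') → _⊏ᵖ_ 𝕄 (f μC) μC)
      × (_⊏ᵖ_ 𝕄 (f μC) μC → ¬ IsFixpoint 𝕄 f μC))
mainTheorem6 𝕄 _ _ _ f _ H isMinDec C μC (μC-fixed , _) =
  improvement-exists , improvement⇒fμC⊏μC , proj₂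
  where
  open MVAlgebra 𝕄
  open NaturalOrder 𝕄
  open MinDecomposition 𝕄 isMinDec

  fμC⊑μC : _⊑ᵖ_ 𝕄 (f μC) μC
  fμC⊑μC y = subst (f μC y ⊑_) (μC-fixed y) (f⊑ᵖinduced C μC y)

  improvement-exists : ¬ IsFixpoint 𝕄 f μC → Σ (Strategy 𝕄 H) (λ C' → IsMinImprovement 𝕄 μC C C')
  improvement-exists notFixed with minimising-strategy μC
  ... | C* , C*≐f = C* , ≐-⊏ᵖ-trans C*≐f (fμC⊑μC , notFixed)

  improvement⇒fμC⊏μC : Σ (Strategy 𝕄 H) (λ C' → IsMinImprovement 𝕄 μC C C') → _⊏ᵖ_ 𝕄 (f μC) μC
  improvement⇒fμC⊏μC (C' , C'μC⊏μC) = ⊑ᵖ-⊏ᵖ-trans (f⊑ᵖinduced C' μC) C'μC⊏μC
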